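{- Let $k\ge 2$ and $n$ be positive integers. Let $A \subseteq S_n$ be an equivalence class under the $\{12\cdots k,\ k\cdots 21\}$-equivalence and let $p_A = a_1a_2\cdots a_n$ be the lexicographically smallest element of $A$. Then for every $1\le i\le n$, the letter $i$ occurs in $p_A$ at some position $j$ with $i-(k-1)^2 \le j \le i+(k-1)^2$.
   Context: $S_n$ is the set of permutations of $\{1,\dots,n\}$ written as words. A pattern-replacement under the $\{12\cdots k, k\cdots 21\}$-equivalence takes $k$ letters of a permutation, at arbitrary (not necessarily adjacent) positions, that are in increasing (resp. decreasing) order and rearranges them within those positions into decreasing (resp. increasing) order; two permutations are equivalent if one is reachable from the other by finitely many such replacements. Lexicographic order compares words from the first letter. -}

module Defs where

open import Data.Nat using (ℕ; suc; _≤_; _<_)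
open import Data.Fin as Fin using (Fin; toℕ; opposite)
open import Data.Vec using (Vec; lookup)
open import Data.Product using (Σ; ∃; _×_; _,_)
open import Data.Sum using (_⊎_)
open import Function.Definitions using (Injective)
open import Relation.Binary.PropositionalEquality using (_≡_; _≢_)
open import Relation.Binary.Construct.Closure.Equivalence using (EqClosure)

-- A word of length n over the alphabet Fin n (letters 0..n-1 stand for 1..n,
-- positions 0..n-1 stand for 1..n).
Word : ℕ → Set
Word n = Vec (Fin n) n

IsPerm : ∀ {n} → Word n → Set
IsPerm w = Injective _≡_ _≡_ (lookup w)

StrictlyIncreasing : ∀ {k n} → (Fin k → Fin n) → Set
StrictlyIncreasing p = ∀ s t → s Fin.< t → p s Fin.< p t

IncToDec : (k : ℕ) → ∀ {n} → Word n → Word n → Set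
IncToDec k {n} w w' =
  Σ (Fin k → Fin n) λ p →
    StrictlyIncreasing p
    × (∀ s t → s Fin.< t → lookup w (p s) Fin.< lookup w (p t))
    × (∀ t → lookup w' (p t) ≡ lookup w (p (opposite t)))
    × (∀ j → (∀ t → p t ≢ j) → lookup w' j ≡ lookup w j)

-- The {12..k, k..21}-equivalence: the equivalence closure of the steps
-- (the k..21 → 12..k replacement is exactly the inverse of a step).
Equiv : (k : ℕ) → ∀ {n} → Word n → Word n → Set
Equiv k = EqClosure (IncToDec k)

IsEquivClass : (k : ℕ) → ∀ {n} → (Word n → Set) → Set
IsEquivClass k {n} A =
  Σ (Word n) λ q → IsPerm q × A q ×
    (∀ r → (A r → IsPerm r × Equiv k q r) × (IsPerm r → Equiv k q r → A r))

_≤lex_ : ∀ {n} → Word n → Word n → Set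
_≤lex_ {n} w v =
  w ≡ v ⊎
  Σ (Fin n) λ j → (∀ i → i Fin.< j → lookup w i ≡ lookup v i)
                  × lookup w j Fin.< lookup v j

{-# OPTIONS --safe #-}
-- Let K = k - 1 and let pA be lexicographically least in its class. One
-- replacement of a decreasing k-letter pattern, or two overlapping replacements
-- in succession, would produce a lexicographically smaller member of the class;
-- so pA has no decreasing subsequence of length k, and no increasing one of
-- length k whose letters all exceed a letter written after it or are all smaller
-- than a letter written before it. Hence the positions before j carrying letters
-- larger than pA(j) contain no monotone subsequence of length k, and by
-- Erdős–Szekeres there are at most K² of them; the other positions before j
-- carry smaller letters, so j ≤ pA(j) + K². Symmetrically pA(j) ≤ j + K², by
-- counting the positions of the letters smaller than pA(j).
module Submission where

open import Defs
open import Data.Nat using (ℕ; suc; _≤_; _+_; _∸_; _^_)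
open import Data.Fin using (Fin; toℕ)
open import Data.Vec using (lookup)
open import Data.Product using (Σ; _×_)
open import Relation.Binary.PropositionalEquality using (_≡_)

open import Data.Nat using (zero; _*_; z≤n; s≤s)
import Data.Nat as ℕ
open import Data.Nat.Properties
  using (∸-monoʳ-<; m≤n⇒m<n∨m≡n; m≤n⇒m≤1+n; 1+n≰n; *-identityʳ; m≤n+o⇒m∸n≤o)
import Data.Nat.Properties as ℕₚ
open import Data.Fin as Fin
  using (zero; suc; _<_; opposite; fromℕ; fromℕ<; inject; Fin′; combine; join; splitAt; punchOut)
open import Data.Fin.Properties
  using ( _≟_; _<?_; <-cmp; <-irrefl; <-asym; <-trans; <⇒≢; any?; toℕ<n; toℕ-inject
        ; toℕ-injective; fromℕ<-injective; opposite-prop; opposite-involutive; ≤fromℕ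
        ; combine-injective; splitAt-join; injective⇒≤; punchOut-injective)
open import Data.Vec using (tabulate)
open import Data.Vec.Properties using (lookup∘tabulate)
open import Data.Vec.Functional using (updateAt)
open import Data.Vec.Functional.Properties using (updateAt-updates; updateAt-minimal)
open import Data.Product using (∃; _,_; proj₁; proj₂)
open import Data.Empty using (⊥; ⊥-elim)
open import Data.Sum using (_⊎_; inj₁; inj₂)
import Data.Sum as Sum
open import Data.Sum.Properties using (inj₁-injective; inj₂-injective)
open import Relation.Nullary using (¬_; Dec; yes; no; contradiction)
open import Relation.Nullary.Decidable using (_×-dec_)
open import Relation.Binary.Definitions using (tri<; tri≈; tri>)
open import Relation.Binary.PropositionalEquality
  using (_≢_; refl; sym; trans; cong; subst; subst₂; module ≡-Reasoning)
open import Relation.Binary.Construct.Closure.ReflexiveTransitive using (ε; _◅_; _◅◅_)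
open import Relation.Binary.Construct.Closure.Symmetric using (fwd; bwd)
open import Function using (_∘_; id; flip)
open import Function.Definitions using (Injective)

OrderedBy : ∀ {k n} → (Fin n → Fin n → Set) → (Fin k → Fin n) → Set
OrderedBy _≺_ p = ∀ s t → s < t → p s ≺ p t

orderedBy-× : ∀ {k n} {P Q : Fin n → Fin n → Set} {p : Fin k → Fin n} →
  OrderedBy (λ a b → P a b × Q a b) p → OrderedBy P p × OrderedBy Q p
orderedBy-× ord = (λ s t s<t → proj₁ (ord s t s<t)) , (λ s t s<t → proj₂ (ord s t s<t))

_<[_]_ : ∀ {n} → Fin n → Word n → Fin n → Set
a <[ w ] b = lookup w a < lookup w b

IncreasingAt DecreasingAt : ∀ {k n} → Word n → (Fin k → Fin n) → Set
IncreasingAt w = OrderedBy _<[ w ]_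
DecreasingAt w = OrderedBy (flip _<[ w ]_)

opposite-< : ∀ {k} {s t : Fin k} → s < t → opposite t < opposite s
opposite-< {k} {s} {t} s<t rewrite opposite-prop s | opposite-prop t =
  ∸-monoʳ-< (s≤s s<t) (toℕ<n t)

strictlyIncreasing⇒injective : ∀ {k n} {p : Fin k → Fin n} →
  StrictlyIncreasing p → Injective _≡_ _≡_ p
strictlyIncreasing⇒injective {p = p} p-inc {s} {t} ps≡pt with <-cmp s t
... | tri< s<t _ _ = contradiction ps≡pt (<⇒≢ (p-inc s t s<t))
... | tri≈ _ s≡t _ = s≡t
... | tri> _ _ t<s = contradiction (sym ps≡pt) (<⇒≢ (p-inc t s t<s))

≢⇒<⊎> : ∀ {n} {x y : Fin n} → x ≢ y → x < y ⊎ y < x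
≢⇒<⊎> {x = x} {y} x≢y with <-cmp x y
... | tri< x<y _ _ = inj₁ x<y
... | tri≈ _ x≡y _ = contradiction x≡y x≢y
... | tri> _ _ y<x = inj₂ y<x

inject-< : ∀ {n} {i : Fin n} (x : Fin′ i) → inject x < i
inject-< {i = i} x = subst (ℕ._< toℕ i) (sym (toℕ-inject x)) (toℕ<n x)

inject-injective : ∀ {n} {i : Fin n} → Injective _≡_ _≡_ (inject {i = i})
inject-injective {x = x} {y} eq = toℕ-injective (begin
  toℕ x          ≡⟨ toℕ-inject x ⟨
  toℕ (inject x) ≡⟨ cong toℕ eq ⟩
  toℕ (inject y) ≡⟨ toℕ-inject y ⟩
  toℕ y          ∎)
  where open ≡-Reasoning

below-first⇒missed : ∀ {k n} {p : Fin (suc k) → Fin n} → StrictlyIncreasing p →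
  ∀ {i} → i < p zero → ∀ t → p t ≢ i
below-first⇒missed p-inc i<p0 zero pt≡i = <⇒≢ i<p0 (sym pt≡i)
below-first⇒missed p-inc i<p0 (suc t) pt≡i =
  <⇒≢ (<-trans i<p0 (p-inc zero (suc t) (s≤s z≤n))) (sym pt≡i)

injective⇒surjective : ∀ {n} {f : Fin n → Fin n} → Injective _≡_ _≡_ f →
  ∀ i → ∃ λ j → f j ≡ i
injective⇒surjective {suc n} {f} f-inj i with any? (λ j → f j ≟ i)
... | yes hit = hit
... | no miss = contradiction (injective⇒≤ punchOut-f-injective) 1+n≰n
  where
  avoids : ∀ j → i ≢ f j
  avoids j i≡fj = miss (j , sym i≡fj)
  punchOut-f-injective : Injective _≡_ _≡_ (λ j → punchOut (avoids j))
  punchOut-f-injective = f-inj ∘ punchOut-injective (avoids _) (avoids _)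

updateAt-ordered : ∀ {k n} {_≺_ : Fin n → Fin n → Set} {p : Fin k → Fin n} {j : Fin n} →
  OrderedBy _≺_ p → ∀ u → (∀ t → t < u → p t ≺ j) → (∀ t → u < t → j ≺ p t) →
  OrderedBy _≺_ (updateAt p u (λ _ → j))
updateAt-ordered {p = p} {j} ord u before after s t s<t with s ≟ u | t ≟ u
... | yes refl | yes refl = contradiction s<t (<-irrefl refl)
... | yes refl | no t≢u
  rewrite updateAt-updates s {λ _ → j} p | updateAt-minimal t s {λ _ → j} p t≢u = after t s<t
... | no s≢u | yes refl
  rewrite updateAt-minimal s t {λ _ → j} p s≢u | updateAt-updates t {λ _ → j} p = before s s<t
... | no s≢u | no t≢u
  rewrite updateAt-minimal s u {λ _ → j} p s≢u | updateAt-minimal t u {λ _ → j} p t≢u = ord s t s<t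

record InjectsInto {n} (P : Fin n → Set) (m : ℕ) : Set where
  field
    code : ∀ {x} → P x → Fin m
    code-injective : ∀ {x y} (px : P x) (py : P y) → code px ≡ code py → x ≡ y
open InjectsInto

below-injects : ∀ {n} {g : Fin n → Fin n} → Injective _≡_ _≡_ g →
  (b : Fin n) → InjectsInto (λ x → g x < b) (toℕ b)
below-injects g-inj b = record
  { code = λ gx<b → fromℕ< gx<b
  ; code-injective = λ gx<b gy<b eq → g-inj (toℕ-injective (fromℕ<-injective _ _ gx<b gy<b eq))
  }

≤-+-by-cover : ∀ {d n a b} {P Q : Fin n → Set} {h : Fin d → Fin n} → Injective _≡_ _≡_ h →
  (∀ x → P (h x) ⊎ Q (h x)) → InjectsInto P a → InjectsInto Q b → d ≤ a + b
≤-+-by-cover {a = a} {b} {P} {Q} {h} h-inj cover ιP ιQ = injective⇒≤ joined-injective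
  where
  tag : ∀ {y} → P y ⊎ Q y → Fin a ⊎ Fin b
  tag = Sum.map (code ιP) (code ιQ)
  tag-injective : ∀ {x y} (u : P x ⊎ Q x) (v : P y ⊎ Q y) → tag u ≡ tag v → x ≡ y
  tag-injective (inj₁ px) (inj₁ py) eq = code-injective ιP px py (inj₁-injective eq)
  tag-injective (inj₂ qx) (inj₂ qy) eq = code-injective ιQ qx qy (inj₂-injective eq)
  tag-injective (inj₁ _) (inj₂ _) ()
  tag-injective (inj₂ _) (inj₁ _) ()
  joined-injective : Injective _≡_ _≡_ (λ x → join a b (tag (cover x)))
  joined-injective {x} {y} eq = h-inj (tag-injective (cover x) (cover y) (begin
    tag (cover x)                         ≡⟨ splitAt-join a b _ ⟨
    splitAt a (join a b (tag (cover x)))  ≡⟨ cong (splitAt a) eq ⟩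
    splitAt a (join a b (tag (cover y)))  ≡⟨ splitAt-join a b _ ⟩
    tag (cover y)                         ∎))
    where open ≡-Reasoning

module Chains {n} {S : Fin n → Set} (S? : ∀ x → Dec (S x))
              {R : Fin n → Fin n → Set} (R? : ∀ x y → Dec (R x y)) where

  -- Chain x ℓ has ℓ + 1 elements.
  Chain : Fin n → ℕ → Set
  Chain x zero = S x
  Chain x (suc ℓ) = S x × ∃ λ y → R x y × Chain y ℓ

  chain? : ∀ x ℓ → Dec (Chain x ℓ)
  chain? x zero = S? x
  chain? x (suc ℓ) = S? x ×-dec any? (λ y → R? x y ×-dec chain? y ℓ)

  longest : ℕ → Fin n → ℕ
  longest zero x = zero
  longest (suc B) x with chain? x (suc B)
  ... | yes _ = suc B
  ... | no _ = longest B x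

  longest-≤ : ∀ B x → longest B x ≤ B
  longest-≤ zero x = z≤n
  longest-≤ (suc B) x with chain? x (suc B)
  ... | yes _ = ℕₚ.≤-refl
  ... | no _ = m≤n⇒m≤1+n (longest-≤ B x)

  longest-chain : ∀ B {x} → S x → Chain x (longest B x)
  longest-chain zero sx = sx
  longest-chain (suc B) {x} sx with chain? x (suc B)
  ... | yes c = c
  ... | no _ = longest-chain B sx

  longest-maximal : ∀ B {x ℓ} → ℓ ≤ B → Chain x ℓ → ℓ ≤ longest B x
  longest-maximal B {ℓ = zero} _ _ = z≤n
  longest-maximal (suc B) {x} {suc ℓ} ℓ<1+B c with chain? x (suc B)
  ... | yes _ = ℓ<1+B
  ... | no ¬c with m≤n⇒m<n∨m≡n ℓ<1+B
  ...   | inj₁ (s≤s ℓ<B) = longest-maximal B ℓ<B c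
  ...   | inj₂ refl = contradiction c ¬c

  sequence : ∀ {x} ℓ → Chain x ℓ → Fin (suc ℓ) → Fin n
  sequence {x} ℓ c zero = x
  sequence (suc ℓ) (_ , _ , _ , c) (suc t) = sequence ℓ c t

  sequence-∈ : ∀ {x} ℓ (c : Chain x ℓ) t → S (sequence ℓ c t)
  sequence-∈ zero sx zero = sx
  sequence-∈ (suc ℓ) (sx , _) zero = sx
  sequence-∈ (suc ℓ) (_ , _ , _ , c) (suc t) = sequence-∈ ℓ c t

  sequence-ordered : (∀ {x y z} → R x y → R y z → R x z) →
    ∀ {x} ℓ (c : Chain x ℓ) → OrderedBy R (sequence ℓ c)
  sequence-ordered R-trans (suc ℓ) (_ , _ , rxy , c) zero (suc t) _ = from-head t
    where
    from-head : ∀ t → R _ (sequence ℓ c t)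
    from-head zero = rxy
    from-head (suc t) = R-trans rxy (sequence-ordered R-trans ℓ c zero (suc t) (s≤s z≤n))
  sequence-ordered R-trans (suc ℓ) (_ , _ , _ , c) (suc s) (suc t) (s≤s s<t) =
    sequence-ordered R-trans ℓ c s t s<t

  module Height (K : ℕ) (no-long : ∀ x → ¬ Chain x K) where

    height : Fin n → ℕ
    height = longest K

    height-< : ∀ {x} → S x → height x ℕ.< K
    height-< {x} sx with m≤n⇒m<n∨m≡n (longest-≤ K x)
    ... | inj₁ lt = lt
    ... | inj₂ eq = contradiction (subst (Chain x) eq (longest-chain K sx)) (no-long x)

    height-decreasing : ∀ {x y} → S x → R x y → S y → height y ℕ.< height x
    height-decreasing sx rxy sy = longest-maximal K (height-< sy) (sx , _ , rxy , longest-chain K sy)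

-- Each element is coded by the lengths of the longest R₁- and R₂-chains starting
-- at it; two comparable elements differ in one of these lengths.
erdős-szekeres : ∀ {n} {S : Fin n → Set} {R₁ R₂ : Fin n → Fin n → Set} (S? : ∀ x → Dec (S x))
  (R₁? : ∀ x y → Dec (R₁ x y)) (R₂? : ∀ x y → Dec (R₂ x y)) (K : ℕ) →
  (∀ x → ¬ Chains.Chain S? R₁? x K) → (∀ x → ¬ Chains.Chain S? R₂? x K) →
  (∀ {x y} → S x → S y → x ≢ y → (R₁ x y ⊎ R₁ y x) ⊎ (R₂ x y ⊎ R₂ y x)) →
  InjectsInto S (K * K)
erdős-szekeres {S = S} {R₁} {R₂} S? R₁? R₂? K no-long₁ no-long₂ comparable =
  record { code = heights ; code-injective = heights-injective }
  where
  module H₁ = Chains.Height S? R₁? K no-long₁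
  module H₂ = Chains.Height S? R₂? K no-long₂

  heights : ∀ {x} → S x → Fin (K * K)
  heights {x} sx = combine (fromℕ< (H₁.height-< sx)) (fromℕ< (H₂.height-< sx))

  differ : ∀ {x y} → S x → S y → x ≢ y →
    H₁.height x ≡ H₁.height y → H₂.height x ≡ H₂.height y → ⊥
  differ sx sy x≢y h₁ h₂ with comparable sx sy x≢y
  ... | inj₁ (inj₁ r) = ℕₚ.<-irrefl (sym h₁) (H₁.height-decreasing sx r sy)
  ... | inj₁ (inj₂ r) = ℕₚ.<-irrefl h₁ (H₁.height-decreasing sy r sx)
  ... | inj₂ (inj₁ r) = ℕₚ.<-irrefl (sym h₂) (H₂.height-decreasing sx r sy)
  ... | inj₂ (inj₂ r) = ℕₚ.<-irrefl h₂ (H₂.height-decreasing sy r sx)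

  heights-injective : ∀ {x y} (sx : S x) (sy : S y) → heights sx ≡ heights sy → x ≡ y
  heights-injective {x} {y} sx sy eq with x ≟ y
  ... | yes x≡y = x≡y
  ... | no x≢y with combine-injective _ _ _ _ eq
  ...   | e₁ , e₂ = ⊥-elim (differ sx sy x≢y
            (fromℕ<-injective _ _ (H₁.height-< sx) (H₁.height-< sy) e₁)
            (fromℕ<-injective _ _ (H₂.height-< sx) (H₂.height-< sy) e₂))

module _ {k n : ℕ} (p : Fin k → Fin n) where

  mirror : Fin n → Fin n
  mirror j with any? (λ t → p t ≟ j)
  ... | yes (t , _) = p (opposite t)
  ... | no _ = j

  reverseAt : Word n → Word n
  reverseAt w = tabulate (lookup w ∘ mirror)

  lookup-reverseAt : ∀ w j → lookup (reverseAt w) j ≡ lookup w (mirror j)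
  lookup-reverseAt w = lookup∘tabulate (lookup w ∘ mirror)

module _ {k n : ℕ} {p : Fin k → Fin n} (p-inj : Injective _≡_ _≡_ p) where

  mirror-on : ∀ t → mirror p (p t) ≡ p (opposite t)
  mirror-on t with any? (λ t′ → p t′ ≟ p t)
  ... | yes (t′ , pt′≡pt) = cong (p ∘ opposite) (p-inj pt′≡pt)
  ... | no miss = contradiction (t , refl) miss

  mirror-off : ∀ {j} → (∀ t → p t ≢ j) → mirror p j ≡ j
  mirror-off {j} missed with any? (λ t → p t ≟ j)
  ... | yes (t , pt≡j) = contradiction pt≡j (missed t)
  ... | no _ = refl

  mirror-involutive : ∀ j → mirror p (mirror p j) ≡ j
  mirror-involutive j with any? (λ t → p t ≟ j)
  ... | yes (t , refl) = trans (mirror-on (opposite t)) (cong p (opposite-involutive t))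
  ... | no miss = mirror-off (λ t pt≡j → miss (t , pt≡j))

  mirror-injective : Injective _≡_ _≡_ (mirror p)
  mirror-injective {a} {b} eq = begin
    a                   ≡⟨ mirror-involutive a ⟨
    mirror p (mirror p a) ≡⟨ cong (mirror p) eq ⟩
    mirror p (mirror p b) ≡⟨ mirror-involutive b ⟩
    b                   ∎
    where open ≡-Reasoning

  reverseAt-on : ∀ w t → lookup (reverseAt p w) (p t) ≡ lookup w (p (opposite t))
  reverseAt-on w t = trans (lookup-reverseAt p w (p t)) (cong (lookup w) (mirror-on t))

  reverseAt-off : ∀ w {j} → (∀ t → p t ≢ j) → lookup (reverseAt p w) j ≡ lookup w j
  reverseAt-off w missed = trans (lookup-reverseAt p w _) (cong (lookup w) (mirror-off missed))

  reverseAt-perm : ∀ w → IsPerm w → IsPerm (reverseAt p w)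
  reverseAt-perm w w-perm {a} {b} eq = mirror-injective (w-perm (begin
    lookup w (mirror p a)   ≡⟨ lookup-reverseAt p w a ⟨
    lookup (reverseAt p w) a ≡⟨ eq ⟩
    lookup (reverseAt p w) b ≡⟨ lookup-reverseAt p w b ⟩
    lookup w (mirror p b)   ∎))
    where open ≡-Reasoning

module _ {k n : ℕ} {p : Fin k → Fin n} (p-inc : StrictlyIncreasing p) where

  private
    p-inj : Injective _≡_ _≡_ p
    p-inj = strictlyIncreasing⇒injective p-inc

  reverseAt-flips : ∀ (_≺_ : Fin n → Fin n → Set) w →
    OrderedBy (λ a b → lookup w a ≺ lookup w b) p →
    OrderedBy (λ a b → lookup (reverseAt p w) b ≺ lookup (reverseAt p w) a) p
  reverseAt-flips _≺_ w ord s t s<t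
    rewrite reverseAt-on p-inj w s | reverseAt-on p-inj w t = ord _ _ (opposite-< s<t)

  reverseAt-equiv : ∀ w → IncreasingAt w p → Equiv k w (reverseAt p w)
  reverseAt-equiv w inc =
    fwd (p , p-inc , inc , reverseAt-on p-inj w , λ _ → reverseAt-off p-inj w) ◅ ε

  reverseAt-equiv⁻¹ : ∀ w → DecreasingAt w p → Equiv k w (reverseAt p w)
  reverseAt-equiv⁻¹ w dec =
    bwd (p , p-inc , reverseAt-flips (flip _<_) w dec , restored , λ _ → sym ∘ reverseAt-off p-inj w)
    ◅ ε
    where
    restored : ∀ t → lookup w (p t) ≡ lookup (reverseAt p w) (p (opposite t))
    restored t rewrite reverseAt-on p-inj w (opposite t) | opposite-involutive t = refl

reverseAt-below : ∀ {k n} {p : Fin (suc k) → Fin n} → StrictlyIncreasing p →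
  ∀ w {i} → i < p zero → lookup (reverseAt p w) i ≡ lookup w i
reverseAt-below p-inc w i<p0 =
  reverseAt-off (strictlyIncreasing⇒injective p-inc) w (below-first⇒missed p-inc i<p0)

module LexMinimal {m n : ℕ} {A : Word n → Set} (A-class : IsEquivClass (2 + m) A)
                  {pA : Word n} (pA∈A : A pA) (pA-minimal : ∀ q → A q → pA ≤lex q) where

  K : ℕ
  K = suc m

  private
    closed : ∀ r → (A r → IsPerm r × Equiv (suc K) (proj₁ A-class) r)
                 × (IsPerm r → Equiv (suc K) (proj₁ A-class) r → A r)
    closed = proj₂ (proj₂ (proj₂ A-class))

  pA-perm : IsPerm pA
  pA-perm = proj₁ (proj₁ (closed pA) pA∈A)

  no-smaller-equivalent : ∀ {w} → Equiv (suc K) pA w → IsPerm w → ∀ j →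
    (∀ i → i < j → lookup w i ≡ lookup pA i) → ¬ (lookup w j < lookup pA j)
  no-smaller-equivalent {w} pA~w w-perm j agree w<pA
    with pA-minimal w (proj₂ (closed w) w-perm (proj₂ (proj₁ (closed pA) pA∈A) ◅◅ pA~w))
  ... | inj₁ refl = <-irrefl refl w<pA
  ... | inj₂ (j′ , agree′ , pA<w) with <-cmp j′ j
  ...   | tri< j′<j _ _ = <-irrefl (sym (agree j′ j′<j)) pA<w
  ...   | tri≈ _ refl _ = <-asym w<pA pA<w
  ...   | tri> _ _ j<j′ = <-irrefl (sym (agree′ j j<j′)) w<pA

  no-decreasing : ∀ {p : Fin (suc K) → Fin n} → StrictlyIncreasing p → ¬ DecreasingAt pA p
  no-decreasing {p} p-inc dec =
    no-smaller-equivalent (reverseAt-equiv⁻¹ p-inc pA dec) (reverseAt-perm p-inj pA pA-perm)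
      (p zero) (λ _ → reverseAt-below p-inc pA)
      (subst (_< lookup pA (p zero)) (sym (reverseAt-on p-inj pA zero))
        (dec zero (fromℕ K) (s≤s z≤n)))
    where
    p-inj : Injective _≡_ _≡_ p
    p-inj = strictlyIncreasing⇒injective p-inc

  -- Reversing q and then r brings the letter that the first reversal left at
  -- r (fromℕ K) to position r zero, and changes nothing before r zero.
  no-smaller-after-two-reversals : ∀ {q r : Fin (suc K) → Fin n} →
    StrictlyIncreasing q → StrictlyIncreasing r → toℕ (r zero) ≤ toℕ (q zero) →
    IncreasingAt pA q → DecreasingAt (reverseAt q pA) r →
    ¬ (lookup (reverseAt q pA) (r (fromℕ K)) < lookup pA (r zero))
  no-smaller-after-two-reversals {q} {r} q-inc r-inc r₀≤q₀ inc dec smaller =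
    no-smaller-equivalent
      (reverseAt-equiv q-inc pA inc ◅◅ reverseAt-equiv⁻¹ r-inc (reverseAt q pA) dec)
      (reverseAt-perm r-inj (reverseAt q pA) (reverseAt-perm q-inj pA pA-perm)) (r zero) agree
      (subst (_< lookup pA (r zero)) (sym (reverseAt-on r-inj (reverseAt q pA) zero)) smaller)
    where
    q-inj : Injective _≡_ _≡_ q
    q-inj = strictlyIncreasing⇒injective q-inc
    r-inj : Injective _≡_ _≡_ r
    r-inj = strictlyIncreasing⇒injective r-inc
    agree : ∀ i → i < r zero → lookup (reverseAt r (reverseAt q pA)) i ≡ lookup pA i
    agree i i<r₀ = trans (reverseAt-below r-inc (reverseAt q pA) i<r₀)
                         (reverseAt-below q-inc pA (ℕₚ.<-≤-trans i<r₀ r₀≤q₀))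

  no-increasing-then-smaller : ∀ {q : Fin (suc K) → Fin n} {j} →
    StrictlyIncreasing q → IncreasingAt pA q → (∀ t → q t < j) →
    ¬ (∀ t → lookup pA j < lookup pA (q t))
  no-increasing-then-smaller {q} {j} q-inc inc q<j smaller =
    no-smaller-after-two-reversals q-inc r-inc ℕₚ.≤-refl inc r-dec
      (subst (_< lookup pA (q zero)) (sym moved) (smaller zero))
    where
    q-inj : Injective _≡_ _≡_ q
    q-inj = strictlyIncreasing⇒injective q-inc
    r : Fin (suc K) → Fin n
    r = updateAt q (fromℕ K) (λ _ → j)
    nothing-after-last : ∀ t → ¬ (fromℕ K < t)
    nothing-after-last t last<t = ℕₚ.<⇒≱ last<t (≤fromℕ t)
    r-inc : StrictlyIncreasing r
    r-inc = updateAt-ordered {_≺_ = _<_} q-inc (fromℕ K) (λ t _ → q<j t)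
      (λ t → ⊥-elim ∘ nothing-after-last t)
    j-untouched : lookup (reverseAt q pA) j ≡ lookup pA j
    j-untouched = reverseAt-off q-inj pA (λ t → <⇒≢ (q<j t))
    r-dec : DecreasingAt (reverseAt q pA) r
    r-dec = updateAt-ordered {_≺_ = flip _<[ reverseAt q pA ]_} (reverseAt-flips q-inc _<_ pA inc)
      (fromℕ K)
      (λ t _ → subst₂ _<_ (sym j-untouched) (sym (reverseAt-on q-inj pA t)) (smaller _))
      (λ t → ⊥-elim ∘ nothing-after-last t)
    moved : lookup (reverseAt q pA) (r (fromℕ K)) ≡ lookup pA j
    moved = trans (cong (lookup (reverseAt q pA)) (updateAt-updates (fromℕ K) q)) j-untouched

  no-larger-then-increasing : ∀ {q : Fin (suc K) → Fin n} {j} →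
    StrictlyIncreasing q → IncreasingAt pA q → (∀ t → j < q t) →
    ¬ (∀ t → lookup pA (q t) < lookup pA j)
  no-larger-then-increasing {q} {j} q-inc inc j<q larger =
    no-smaller-after-two-reversals q-inc r-inc (ℕₚ.<⇒≤ (j<q zero)) inc r-dec
      (subst (_< lookup pA j) (sym moved) (larger zero))
    where
    q-inj : Injective _≡_ _≡_ q
    q-inj = strictlyIncreasing⇒injective q-inc
    r : Fin (suc K) → Fin n
    r = updateAt q zero (λ _ → j)
    r-inc : StrictlyIncreasing r
    r-inc = updateAt-ordered {_≺_ = _<_} q-inc zero (λ _ ()) (λ t _ → j<q t)
    j-untouched : lookup (reverseAt q pA) j ≡ lookup pA j
    j-untouched = reverseAt-off q-inj pA (λ t qt≡j → <⇒≢ (j<q t) (sym qt≡j))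
    r-dec : DecreasingAt (reverseAt q pA) r
    r-dec = updateAt-ordered {_≺_ = flip _<[ reverseAt q pA ]_} (reverseAt-flips q-inc _<_ pA inc)
      zero (λ _ ())
      (λ t _ → subst₂ _<_ (sym (reverseAt-on q-inj pA t)) (sym j-untouched) (larger _))
    moved : lookup (reverseAt q pA) (r (fromℕ K)) ≡ lookup pA (q zero)
    moved = trans (reverseAt-on q-inj pA (fromℕ K)) (cong (lookup pA ∘ q) (opposite-involutive zero))

  Rising Falling EarlierLarger LaterSmaller : Fin n → Fin n → Set
  Rising x y = x < y × x <[ pA ] y
  Falling x y = x < y × y <[ pA ] x
  EarlierLarger j x = x < j × j <[ pA ] x
  LaterSmaller j x = j < x × x <[ pA ] j

  rising? : ∀ x y → Dec (Rising x y)
  rising? x y = x <? y ×-dec lookup pA x <? lookup pA y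

  falling? : ∀ x y → Dec (Falling x y)
  falling? x y = x <? y ×-dec lookup pA y <? lookup pA x

  earlierLarger? : ∀ j x → Dec (EarlierLarger j x)
  earlierLarger? j x = x <? j ×-dec lookup pA j <? lookup pA x

  laterSmaller? : ∀ j x → Dec (LaterSmaller j x)
  laterSmaller? j x = j <? x ×-dec lookup pA x <? lookup pA j

  rising-trans : ∀ {x y z} → Rising x y → Rising y z → Rising x z
  rising-trans (x<y , a) (y<z , b) = <-trans x<y y<z , <-trans a b

  falling-trans : ∀ {x y z} → Falling x y → Falling y z → Falling x z
  falling-trans (x<y , a) (y<z , b) = <-trans x<y y<z , <-trans b a

  letter-split : ∀ {x y} → x ≢ y → x <[ pA ] y ⊎ y <[ pA ] x
  letter-split x≢y = ≢⇒<⊎> (x≢y ∘ pA-perm)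

  rising-or-falling : ∀ {x y} → x ≢ y → (Rising x y ⊎ Rising y x) ⊎ (Falling x y ⊎ Falling y x)
  rising-or-falling x≢y with ≢⇒<⊎> x≢y | letter-split x≢y
  ... | inj₁ x<y | inj₁ up   = inj₁ (inj₁ (x<y , up))
  ... | inj₁ x<y | inj₂ down = inj₂ (inj₁ (x<y , down))
  ... | inj₂ y<x | inj₁ up   = inj₂ (inj₂ (y<x , up))
  ... | inj₂ y<x | inj₂ down = inj₁ (inj₂ (y<x , down))

  monotone-free-injects : ∀ {S : Fin n → Set} (S? : ∀ x → Dec (S x)) →
    (∀ {p : Fin (suc K) → Fin n} → StrictlyIncreasing p → IncreasingAt pA p → ¬ (∀ t → S (p t))) →
    InjectsInto S (K * K)
  monotone-free-injects S? no-rising =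
    erdős-szekeres S? rising? falling? K no-long-rising no-long-falling (λ _ _ → rising-or-falling)
    where
    open Chains S?
    no-long-rising : ∀ x → ¬ Chain rising? x K
    no-long-rising x c
      with orderedBy-× {P = _<_} {Q = _<[ pA ]_} (sequence-ordered rising? rising-trans K c)
    ... | p-inc , inc = no-rising p-inc inc (sequence-∈ rising? K c)
    no-long-falling : ∀ x → ¬ Chain falling? x K
    no-long-falling x c
      with orderedBy-× {P = _<_} {Q = flip _<[ pA ]_} (sequence-ordered falling? falling-trans K c)
    ... | p-inc , dec = no-decreasing p-inc dec

  earlierLarger-injects : ∀ j → InjectsInto (EarlierLarger j) (K * K)
  earlierLarger-injects j = monotone-free-injects (earlierLarger? j) λ p-inc inc ∈ →
    no-increasing-then-smaller p-inc inc (proj₁ ∘ ∈) (proj₂ ∘ ∈)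

  laterSmaller-injects : ∀ j → InjectsInto (LaterSmaller j) (K * K)
  laterSmaller-injects j = monotone-free-injects (laterSmaller? j) λ p-inc inc ∈ →
    no-larger-then-increasing p-inc inc (proj₁ ∘ ∈) (proj₂ ∘ ∈)

  position≤letter+K² : ∀ j → toℕ j ≤ toℕ (lookup pA j) + K * K
  position≤letter+K² j =
    ≤-+-by-cover inject-injective cover (below-injects pA-perm (lookup pA j)) (earlierLarger-injects j)
    where
    cover : ∀ x → inject x <[ pA ] j ⊎ EarlierLarger j (inject x)
    cover x = Sum.map₂ (inject-< x ,_) (letter-split (<⇒≢ (inject-< x)))

  position : Fin n → Fin n
  position ℓ = proj₁ (injective⇒surjective pA-perm ℓ)

  lookup-position : ∀ ℓ → lookup pA (position ℓ) ≡ ℓ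
  lookup-position ℓ = proj₂ (injective⇒surjective pA-perm ℓ)

  letter≤K²+position : ∀ j → toℕ (lookup pA j) ≤ K * K + toℕ j
  letter≤K²+position j =
    ≤-+-by-cover position-inject-injective cover (laterSmaller-injects j) (below-injects id j)
    where
    position-inject-injective : Injective _≡_ _≡_ (position ∘ inject {i = lookup pA j})
    position-inject-injective {x} {y} eq = inject-injective (begin
      inject x                           ≡⟨ lookup-position (inject x) ⟨
      lookup pA (position (inject x))    ≡⟨ cong (lookup pA) eq ⟩
      lookup pA (position (inject y))    ≡⟨ lookup-position (inject y) ⟩
      inject y                           ∎)
      where open ≡-Reasoning
    smaller : ∀ x → position (inject x) <[ pA ] j
    smaller x = subst (_< lookup pA j) (sym (lookup-position (inject x))) (inject-< x)
    cover : ∀ x → LaterSmaller j (position (inject x)) ⊎ position (inject x) < j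
    cover x with ≢⇒<⊎> (λ y≡j → <⇒≢ (smaller x) (cong (lookup pA) y≡j))
    ... | inj₁ y<j = inj₂ y<j
    ... | inj₂ j<y = inj₁ (j<y , smaller x)

corollary2p2 : (k n : ℕ) → 2 ≤ k → 1 ≤ n →
    (A : Word n → Set) → IsEquivClass k A →
    (pA : Word n) → A pA → (∀ q → A q → pA ≤lex q) →
    (i : Fin n) → Σ (Fin n) λ j → lookup pA j ≡ i
      × toℕ i ∸ (k ∸ 1) ^ 2 ≤ toℕ j × toℕ j ≤ toℕ i + (k ∸ 1) ^ 2
corollary2p2 (suc (suc m)) n (s≤s (s≤s z≤n)) _ A A-class pA pA∈A pA-minimal i
  with j , refl ← injective⇒surjective (LexMinimal.pA-perm A-class pA∈A pA-minimal) i =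
  j , refl , lower , upper
  where
  open LexMinimal A-class pA∈A pA-minimal
  K^2≡K*K : K ^ 2 ≡ K * K
  K^2≡K*K = cong (K *_) (*-identityʳ K)
  upper : toℕ j ≤ toℕ (lookup pA j) + K ^ 2
  upper rewrite K^2≡K*K = position≤letter+K² j
  lower : toℕ (lookup pA j) ∸ K ^ 2 ≤ toℕ j
  lower rewrite K^2≡K*K = m≤n+o⇒m∸n≤o (toℕ (lookup pA j)) (K * K) (letter≤K²+position j)
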